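{- Let $\mathcal D=(\mathcal P,\mathcal B,\mathcal I)$ be a $(v,b,r,k,\lambda_1,0)$ SPBIBD of type $(k-1,t)$ with $0<t<k$, and let $\Gamma$ be its incidence graph. Then every vertex $p\in\mathcal P$ is distance-regularized, and $\Gamma$ is distance-semiregular with respect to $\mathcal P$ with intersection numbers $c_0=0$, $c_1=1$, $c_2=\lambda_1$, $c_3=t$, $c_4=r$, $b_0=r$, $b_1=k-1$, $b_2=r-\lambda_1$, $b_3=k-t$, $b_4=0$.
   Context: An incidence structure $\mathcal D=(\mathcal P,\mathcal B,\mathcal I)$ has finite point set $\mathcal P$, block set $\mathcal B$, incidence $\mathcal I\subseteq\mathcal P\times\mathcal B$ (write $p\in B$). $(p,B)$ is a flag if $p\in B$, a non-flag otherwise. A $(v,b,r,k,\lambda_1,\lambda_2)$ SPBIBD of type $(s,t)$: $|\mathcal P|=v$, $|\mathcal B|=b$, each block has $k$ points, each point lies in $r$ blocks; any two distinct points lie together in exactly $\lambda_1$ or exactly $\lambda_2$ blocks; for every flag $(p,B)$ exactly $s$ points of $B$ other than $p$ lie together with $p$ in exactly $\lambda_1$ blocks; for every non-flag $(p,B)$ exactly $t$ points of $B$ lie together with $p$ in exactly $\lambda_1$ blocks. Standing assumptions: $v>k\ge2$, $r<b$. The incidence graph is the bipartite graph on $\mathcal P\cup\mathcal B$ with $p\sim B$ iff $p\in B$. In a graph, $\Gamma_i(u)$ is the set of vertices at distance $i$ from $u$, $\Gamma(u)=\Gamma_1(u)$. A vertex $u$ is distance-regularized if for every $0\le i\le$ (eccentricity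 of $u$) the numbers $c_i(u)=|\Gamma_{i-1}(u)\cap\Gamma(w)|$, $a_i(u)=|\Gamma_i(u)\cap\Gamma(w)|$, $b_i(u)=|\Gamma_{i+1}(u)\cap\Gamma(w)|$ do not depend on $w\in\Gamma_i(u)$. A connected bipartite graph with color classes $Y,Y'$ is distance-semiregular with respect to $Y$ if there are constants $b_i,c_i$ with $b_i(u)=b_i$, $c_i(u)=c_i$ for every $u\in Y$ (i.e., for all $u\in Y$, $w\in\Gamma_i(u)$). -}

module Defs where

open import Data.Bool using (Bool; true; false; _∧_; _∨_; not; if_then_else_)
open import Data.Nat using (ℕ; zero; suc; _<_; _≤_; _≡ᵇ_)
open import Data.Fin using (Fin)
open import Data.Fin.Properties using () renaming (_≟_ to _≟ᶠ_)
open import Data.List using (List; map; _++_; allFin)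
open import Data.Nat.ListAction using (sum)
open import Data.Bool.ListAction using (any)
open import Data.Sum using (_⊎_; inj₁; inj₂)
open import Data.Product using (_×_; ∃)
open import Relation.Nullary.Decidable using (⌊_⌋)
open import Relation.Binary using (DecidableEquality)
open import Relation.Binary.PropositionalEquality using (_≡_; _≢_)

countL : {V : Set} → List V → (V → Bool) → ℕ
countL xs f = sum (map (λ x → if f x then 1 else 0) xs)

countFin : (n : ℕ) → (Fin n → Bool) → ℕ
countFin n f = countL (allFin n) f

record FinGraph : Set₁ where
  field
    V     : Set
    enum  : List V
    _≟V_  : DecidableEquality V
    adj   : V → V → Bool

module GraphNotions (G : FinGraph) where
  open FinGraph G

  count : (V → Bool) → ℕ
  count = countL enum

  within : ℕ → V → V → Bool
  within zero    u w = ⌊ u ≟V w ⌋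
  within (suc n) u w = within n u w ∨ any (λ x → adj x w ∧ within n u x) enum

  atDist : ℕ → V → V → Bool
  atDist zero    u w = within zero u w
  atDist (suc i) u w = within (suc i) u w ∧ not (within i u w)

  -- c_i, a_i, b_i of u, evaluated at w (Γ_{-1}(u) = ∅)
  cNum : ℕ → V → V → ℕ
  cNum zero    u w = 0
  cNum (suc i) u w = count (λ x → adj w x ∧ atDist i u x)

  aNum : ℕ → V → V → ℕ
  aNum i u w = count (λ x → adj w x ∧ atDist i u x)

  bNum : ℕ → V → V → ℕ
  bNum i u w = count (λ x → adj w x ∧ atDist (suc i) u x)

  Connected : Set
  Connected = ∀ u w → ∃ λ n → within n u w ≡ true

  DistanceRegularized : V → Set
  DistanceRegularized u =
    ∀ i w w' → atDist i u w ≡ true → atDist i u w' ≡ true →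
      (cNum i u w ≡ cNum i u w') × (aNum i u w ≡ aNum i u w') × (bNum i u w ≡ bNum i u w')

  BipartiteWrt : (V → Bool) → Set
  BipartiteWrt Y = ∀ x y → adj x y ≡ true → Y x ≢ Y y

  DistanceSemiregular : (Y : V → Bool) → (bs cs : ℕ → ℕ) → Set
  DistanceSemiregular Y bs cs =
    Connected × BipartiteWrt Y ×
    (∀ u → Y u ≡ true → ∀ i w → atDist i u w ≡ true →
       (bNum i u w ≡ bs i) × (cNum i u w ≡ cs i))

lam : {v b : ℕ} → (Fin v → Fin b → Bool) → Fin v → Fin v → ℕ
lam {v} {b} I p q = countFin b (λ B → I p B ∧ I q B)

record SPBIBD (v b r k λ₁ λ₂ s t : ℕ) (I : Fin v → Fin b → Bool) : Set where
  field
    k<v        : k < v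
    2≤k        : 2 ≤ k
    r<b        : r < b
    blockSize  : ∀ B → countFin v (λ p → I p B) ≡ k
    replication : ∀ p → countFin b (λ B → I p B) ≡ r
    pairs      : ∀ p q → p ≢ q → (lam I p q ≡ λ₁) ⊎ (lam I p q ≡ λ₂)
    flagCond   : ∀ p B → I p B ≡ true →
                   countFin v (λ q → I q B ∧ not ⌊ p ≟ᶠ q ⌋ ∧ (lam I p q ≡ᵇ λ₁)) ≡ s
    nonFlagCond : ∀ p B → I p B ≡ false →
                   countFin v (λ q → I q B ∧ (lam I p q ≡ᵇ λ₁)) ≡ t

incAdj : {v b : ℕ} → (Fin v → Fin b → Bool) → Fin v ⊎ Fin b → Fin v ⊎ Fin b → Bool
incAdj I (inj₁ p) (inj₂ B) = I p B
incAdj I (inj₂ B) (inj₁ p) = I p B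
incAdj I (inj₁ _) (inj₁ _) = false
incAdj I (inj₂ _) (inj₂ _) = false

decSum : {v b : ℕ} → DecidableEquality (Fin v ⊎ Fin b)
decSum = Data.Sum.Properties.≡-dec _≟ᶠ_ _≟ᶠ_
  where import Data.Sum.Properties

IncidenceGraph : {v b : ℕ} → (Fin v → Fin b → Bool) → FinGraph
IncidenceGraph {v} {b} I = record
  { V = Fin v ⊎ Fin b
  ; enum = map inj₁ (allFin v) ++ map inj₂ (allFin b)
  ; _≟V_ = decSum
  ; adj = incAdj I
  }

isPoint : {v b : ℕ} → Fin v ⊎ Fin b → Bool
isPoint (inj₁ _) = true
isPoint (inj₂ _) = false

-- intersection numbers claimed in Lemma 4.2 (values for i ≥ 5 are vacuous)
cSeq : (λ₁ t r : ℕ) → ℕ → ℕ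
cSeq λ₁ t r 0 = 0
cSeq λ₁ t r 1 = 1
cSeq λ₁ t r 2 = λ₁
cSeq λ₁ t r 3 = t
cSeq λ₁ t r 4 = r
cSeq λ₁ t r _ = 0

bSeq : (r k λ₁ t : ℕ) → ℕ → ℕ
bSeq r k λ₁ t 0 = r
bSeq r k λ₁ t 1 = Data.Nat._∸_ k 1
bSeq r k λ₁ t 2 = Data.Nat._∸_ r λ₁
bSeq r k λ₁ t 3 = Data.Nat._∸_ k t
bSeq r k λ₁ t _ = 0

-- Around a point p the balls of the incidence graph are explicit: Γ≤1(p) is p
-- with its blocks; Γ≤2(p) adds the points collinear with p, i.e. those sharing a
-- block with p, which (as λ₂ = 0) are exactly those with λ(p,q) = λ₁; Γ≤3(p) adds
-- every other block, since t > 0 gives each block missing p a point collinear with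
-- p; Γ≤4(p) is everything. The neighbours of a vertex in each shell are then
-- counted by the axioms: s = k − 1 for a block through p, λ₁ and r − λ₁ for a
-- collinear point, t and k − t for a block missing p, and r for a point at
-- distance 4, none of whose blocks contains p.

module Submission where

open import Defs
open import Data.Bool using (Bool; true; false; _∧_; _∨_; not; if_then_else_)
open import Data.Bool.Properties
  using (T-≡; ∧-comm; ∧-identityʳ; ∧-idem; ∧-zeroʳ; ∧-inverseʳ
        ; ∨-identityʳ; ∨-zeroʳ; ∨-idem; ∨-assoc; not-injective)
open import Data.Bool.ListAction using (any)
open import Data.Fin using (Fin; fromℕ<) renaming (zero to fzero; suc to fsuc)
open import Data.Fin.Properties using () renaming (_≟_ to _≟ᶠ_)
open import Data.List using (List; []; _∷_; map; _++_; allFin)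
open import Data.List.Membership.Propositional using (_∈_)
open import Data.List.Membership.Propositional.Properties using (∈-allFin; ∈-map⁺; ∈-++⁺ˡ; ∈-++⁺ʳ)
open import Data.List.Properties using (map-++; map-∘; map-tabulate)
open import Data.List.Relation.Unary.Any using (here; there)
open import Data.Nat using (ℕ; zero; suc; _<_; _+_; _∸_; _≡ᵇ_; z≤n; s≤s)
open import Data.Nat.ListAction using (sum)
open import Data.Nat.ListAction.Properties using (sum-++)
open import Data.Nat.Properties using (+-suc; +-identityʳ; m+n∸m≡n; m<n⇒0<n∸m; ≡ᵇ⇒≡; ≡⇒≡ᵇ; ≤-trans)
open import Data.Product using (∃; _×_; _,_)
open import Data.Sum using (_⊎_; inj₁; inj₂)
open import Function using (_∘_; id)
open import Function.Bundles using (Equivalence)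
open import Relation.Binary using (DecidableEquality)
open import Relation.Binary.PropositionalEquality
open import Relation.Nullary.Decidable using (⌊_⌋; yes; no; toWitness; dec-true; isYes≗does)

∧-true⁻ : {x y : Bool} → x ∧ y ≡ true → x ≡ true × y ≡ true
∧-true⁻ {true} y≡true = refl , y≡true

∨-true⁻ : {x y : Bool} → x ∨ y ≡ true → x ≡ true ⊎ y ≡ true
∨-true⁻ {true}  _        = inj₁ refl
∨-true⁻ {false} y≡true = inj₂ y≡true

∨-∧-not : (x y : Bool) → (x ∨ y) ∧ not x ≡ not x ∧ y
∨-∧-not true  y = refl
∨-∧-not false y = ∧-identityʳ y

∧-contradiction : (x y : Bool) → x ∧ (y ∧ not y) ≡ false
∧-contradiction x y = trans (cong (x ∧_) (∧-inverseʳ y)) (∧-zeroʳ x)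

≡ᵇ-true⇒≡ : {m n : ℕ} → (m ≡ᵇ n) ≡ true → m ≡ n
≡ᵇ-true⇒≡ {m} {n} e = ≡ᵇ⇒≡ m n (Equivalence.from T-≡ e)

isYes-sound : {A : Set} {x y : A} (d : DecidableEquality A) → ⌊ d x y ⌋ ≡ true → x ≡ y
isYes-sound d e = toWitness (Equivalence.from T-≡ e)

indicator : {A : Set} → (A → Bool) → A → ℕ
indicator f x = if f x then 1 else 0

module _ {A : Set} where

  countL-cong : (xs : List A) {f g : A → Bool} → (∀ x → f x ≡ g x) → countL xs f ≡ countL xs g
  countL-cong []       f≗g = refl
  countL-cong (x ∷ xs) f≗g rewrite f≗g x = cong (_ +_) (countL-cong xs f≗g)

  countL-∧-cong : (xs : List A) {h f g : A → Bool} → (∀ x → h x ≡ true → f x ≡ g x) →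
                  countL xs (λ x → h x ∧ f x) ≡ countL xs (λ x → h x ∧ g x)
  countL-∧-cong xs {h} {f} {g} f≗g = countL-cong xs pointwise
    where
    pointwise : ∀ x → h x ∧ f x ≡ h x ∧ g x
    pointwise x with h x in hx
    ... | true  = f≗g x hx
    ... | false = refl

  countL-none : (xs : List A) {f : A → Bool} → (∀ x → f x ≡ false) → countL xs f ≡ 0
  countL-none []       f≗false = refl
  countL-none (x ∷ xs) f≗false rewrite f≗false x = countL-none xs f≗false

  countL-++ : (xs ys : List A) (f : A → Bool) → countL (xs ++ ys) f ≡ countL xs f + countL ys f
  countL-++ xs ys f = trans (cong sum (map-++ (indicator f) xs ys)) (sum-++ (map (indicator f) xs) _)

  countL-map : {B : Set} (h : B → A) (xs : List B) (f : A → Bool) → countL (map h xs) f ≡ countL xs (f ∘ h)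
  countL-map h xs f = cong sum (sym (map-∘ {g = indicator f} {f = h} xs))

  countL-split : (xs : List A) (f g : A → Bool) →
                 countL xs f ≡ countL xs (λ x → f x ∧ g x) + countL xs (λ x → f x ∧ not (g x))
  countL-split []       f g = refl
  countL-split (x ∷ xs) f g with f x | g x
  ... | true  | true  = cong suc (countL-split xs f g)
  ... | true  | false = trans (cong suc (countL-split xs f g)) (sym (+-suc _ _))
  ... | false | _     = countL-split xs f g

  countL-∧-not : (xs : List A) (f g : A → Bool) {m n : ℕ} →
                 countL xs f ≡ m → countL xs (λ x → f x ∧ g x) ≡ n →
                 countL xs (λ x → f x ∧ not (g x)) ≡ m ∸ n
  countL-∧-not xs f g refl refl = sym (begin
    countL xs f ∸ both                                     ≡⟨ cong (_∸ both) (countL-split xs f g) ⟩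
    both + countL xs (λ x → f x ∧ not (g x)) ∸ both        ≡⟨ m+n∸m≡n both _ ⟩
    countL xs (λ x → f x ∧ not (g x))                      ∎)
    where
    open ≡-Reasoning
    both : ℕ
    both = countL xs (λ x → f x ∧ g x)

  countL-pos : {xs : List A} (f : A → Bool) {x : A} → x ∈ xs → f x ≡ true → 0 < countL xs f
  countL-pos f (here refl) fx rewrite fx = s≤s z≤n
  countL-pos {y ∷ _} f (there x∈xs) fx with f y
  ... | true  = s≤s z≤n
  ... | false = countL-pos f x∈xs fx

  countL-witness : (xs : List A) (f : A → Bool) → 0 < countL xs f → ∃ λ x → f x ≡ true
  countL-witness (x ∷ xs) f pos with f x in fx
  ... | true  = x , fx
  ... | false = countL-witness xs f pos

  any-intro : {xs : List A} (f : A → Bool) {x : A} → x ∈ xs → f x ≡ true → any f xs ≡ true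
  any-intro f (here refl) fx rewrite fx = refl
  any-intro {y ∷ _} f (there x∈xs) fx with f y
  ... | true  = refl
  ... | false = any-intro f x∈xs fx

  any-witness : (xs : List A) (f : A → Bool) → any f xs ≡ true → ∃ λ x → f x ≡ true
  any-witness (x ∷ xs) f anyf with f x in fx
  ... | true  = x , fx
  ... | false = any-witness xs f anyf

  any-cong : (xs : List A) {f g : A → Bool} → (∀ x → f x ≡ g x) → any f xs ≡ any g xs
  any-cong []       f≗g = refl
  any-cong (x ∷ xs) f≗g rewrite f≗g x = cong (_ ∨_) (any-cong xs f≗g)

  any≡countL≢0 : (xs : List A) (f : A → Bool) → any f xs ≡ not (countL xs f ≡ᵇ 0)
  any≡countL≢0 []       f = refl
  any≡countL≢0 (x ∷ xs) f with f x
  ... | true  = refl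
  ... | false = any≡countL≢0 xs f

countFin-suc : (n : ℕ) (f : Fin (suc n) → Bool) →
               countFin (suc n) f ≡ indicator f fzero + countFin n (f ∘ fsuc)
countFin-suc n f = cong (indicator f fzero +_)
  (trans (cong (λ xs → countL xs f) (sym (map-tabulate id fsuc))) (countL-map fsuc (allFin n) f))

countFin-∧-≟ : {n : ℕ} (f : Fin n → Bool) (p : Fin n) →
               countFin n (λ q → f q ∧ ⌊ p ≟ᶠ q ⌋) ≡ indicator f p
countFin-∧-≟ {suc n} f fzero
  rewrite countFin-suc n (λ q → f q ∧ ⌊ fzero ≟ᶠ q ⌋) | ∧-identityʳ (f fzero)
  = trans (cong (indicator f fzero +_) (countL-none (allFin n) (λ q → ∧-zeroʳ (f (fsuc q))))) (+-identityʳ _)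
countFin-∧-≟ {suc n} f (fsuc p)
  rewrite countFin-suc n (λ q → f q ∧ ⌊ fsuc p ≟ᶠ q ⌋) | ∧-zeroʳ (f fzero)
  = trans (countL-cong (allFin n) (λ q → cong (f (fsuc q) ∧_) (isYes-fsuc q))) (countFin-∧-≟ (f ∘ fsuc) p)
  where
  -- ⌊_⌋ of the mapped decision is not definitionally ⌊ p ≟ᶠ q ⌋, but its `does` is.
  isYes-fsuc : ∀ q → ⌊ fsuc p ≟ᶠ fsuc q ⌋ ≡ ⌊ p ≟ᶠ q ⌋
  isYes-fsuc q = trans (isYes≗does _) (sym (isYes≗does _))

module GraphLemmas (G : FinGraph) where
  open FinGraph G
  open GraphNotions G

  within-refl : ∀ u → within 0 u u ≡ true
  within-refl u = trans (isYes≗does _) (dec-true (u ≟V u) refl)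

  module _ (complete : ∀ x → x ∈ enum) where

    within-step : ∀ n {u x w} → within n u x ≡ true → adj x w ≡ true → within (suc n) u w ≡ true
    within-step n {u} {x} {w} ux xw =
      trans (cong (within n u w ∨_) (any-intro _ (complete x) (cong₂ _∧_ xw ux))) (∨-zeroʳ _)

    within-trans : ∀ m n {u x w} → within m u x ≡ true → within n x w ≡ true → within (n + m) u w ≡ true
    within-trans m zero    ux xw with refl ← isYes-sound _≟V_ xw = ux
    within-trans m (suc n) {u} {x} {w} ux xw with ∨-true⁻ xw
    ... | inj₁ xw′ = cong (_∨ any (λ y → adj y w ∧ within (n + m) u y) enum) (within-trans m n ux xw′)
    ... | inj₂ step with y , yw×xy ← any-witness enum _ step with yw , xy ← ∧-true⁻ yw×xy
      = within-step (n + m) (within-trans m n ux xy) yw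

  shell : (ℕ → V → Bool) → ℕ → V → Bool
  shell ball zero    w = ball zero w
  shell ball (suc i) w = ball (suc i) w ∧ not (ball i w)

  module Balls {u : V} {ball : ℕ → V → Bool} (ball-zero : ∀ w → within 0 u w ≡ ball 0 w)
           (ball-suc : ∀ n w → ball (suc n) w ≡ ball n w ∨ any (λ x → adj x w ∧ ball n x) enum) where

    within≡ball : ∀ n w → within n u w ≡ ball n w
    within≡ball zero    w = ball-zero w
    within≡ball (suc n) w rewrite within≡ball n w =
      trans (cong (ball n w ∨_) (any-cong enum (λ x → cong (adj x w ∧_) (within≡ball n x)))) (sym (ball-suc n w))

    atDist≡shell : ∀ i w → atDist i u w ≡ shell ball i w
    atDist≡shell zero    w = ball-zero w
    atDist≡shell (suc i) w rewrite within≡ball (suc i) w | within≡ball i w = refl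

    count-atDist≡count-shell : ∀ i w →
      count (λ x → adj w x ∧ atDist i u x) ≡ count (λ x → adj w x ∧ shell ball i x)
    count-atDist≡count-shell i w = countL-cong enum (λ x → cong (adj w x ∧_) (atDist≡shell i x))

module IncidenceGraphLemmas {v b : ℕ} (I : Fin v → Fin b → Bool) where
  open FinGraph (IncidenceGraph I) using (V; enum)
  open GraphNotions (IncidenceGraph I)
  open GraphLemmas (IncidenceGraph I) public

  enum-complete : ∀ x → x ∈ enum
  enum-complete (inj₁ p) = ∈-++⁺ˡ (∈-map⁺ inj₁ (∈-allFin p))
  enum-complete (inj₂ B) = ∈-++⁺ʳ (map inj₁ (allFin v)) (∈-map⁺ inj₂ (∈-allFin B))

  count-⊎ : (h : V → Bool) → count h ≡ countFin v (h ∘ inj₁) + countFin b (h ∘ inj₂)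
  count-⊎ h = trans (countL-++ (map inj₁ (allFin v)) (map inj₂ (allFin b)) h)
                    (cong₂ _+_ (countL-map inj₁ (allFin v) h) (countL-map inj₂ (allFin b) h))

  count-around-point : (q : Fin v) (f : V → Bool) →
                       count (λ x → incAdj I (inj₁ q) x ∧ f x) ≡ countFin b (λ B → I q B ∧ f (inj₂ B))
  count-around-point q f =
    trans (count-⊎ _) (cong (_+ countFin b (λ B → I q B ∧ f (inj₂ B))) (countL-none (allFin v) (λ _ → refl)))

  count-around-block : (B : Fin b) (f : V → Bool) →
                       count (λ x → incAdj I (inj₂ B) x ∧ f x) ≡ countFin v (λ q → I q B ∧ f (inj₁ q))
  count-around-block B f =
    trans (count-⊎ _) (trans (cong (countFin v (λ q → I q B ∧ f (inj₁ q)) +_) (countL-none (allFin b) (λ _ → refl)))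
                             (+-identityʳ _))

  incAdj-sym : ∀ x y → incAdj I x y ≡ incAdj I y x
  incAdj-sym (inj₁ _) (inj₁ _) = refl
  incAdj-sym (inj₁ _) (inj₂ _) = refl
  incAdj-sym (inj₂ _) (inj₁ _) = refl
  incAdj-sym (inj₂ _) (inj₂ _) = refl

  any-adj≡count≢0 : (w : V) (f : V → Bool) →
                    any (λ x → incAdj I x w ∧ f x) enum ≡ not (count (λ x → incAdj I w x ∧ f x) ≡ᵇ 0)
  any-adj≡count≢0 w f = trans (any≡countL≢0 enum _)
    (cong (λ n → not (n ≡ᵇ 0)) (countL-cong enum (λ x → cong (_∧ f x) (incAdj-sym x w))))

  any-adj-point : (q : Fin v) (f : V → Bool) →
                  any (λ x → incAdj I x (inj₁ q) ∧ f x) enum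
                  ≡ not (countFin b (λ B → I q B ∧ f (inj₂ B)) ≡ᵇ 0)
  any-adj-point q f = trans (any-adj≡count≢0 (inj₁ q) f) (cong (λ n → not (n ≡ᵇ 0)) (count-around-point q f))

  any-adj-block : (B : Fin b) (f : V → Bool) →
                  any (λ x → incAdj I x (inj₂ B) ∧ f x) enum
                  ≡ not (countFin v (λ q → I q B ∧ f (inj₁ q)) ≡ᵇ 0)
  any-adj-block B f = trans (any-adj≡count≢0 (inj₂ B) f) (cong (λ n → not (n ≡ᵇ 0)) (count-around-block B f))

  incidence-bipartite : BipartiteWrt isPoint
  incidence-bipartite (inj₁ _) (inj₂ _) _ ()
  incidence-bipartite (inj₂ _) (inj₁ _) _ ()

  lam-sym : ∀ p q → lam I p q ≡ lam I q p
  lam-sym p q = countL-cong (allFin b) (λ B → ∧-comm (I p B) (I q B))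

  lam-pos : ∀ {p q} B → I p B ≡ true → I q B ≡ true → 0 < lam I p q
  lam-pos {p} {q} B pB qB = countL-pos (λ B → I p B ∧ I q B) (∈-allFin B) (cong₂ _∧_ pB qB)

module SPBIBDLemmas {v b r k λ₁ t : ℕ} {I : Fin v → Fin b → Bool}
                    (D : SPBIBD v b r k λ₁ 0 (k ∸ 1) t I) (0<t : 0 < t) where
  open SPBIBD D
  open FinGraph (IncidenceGraph I) using (V; enum)
  open GraphNotions (IncidenceGraph I)
  open IncidenceGraphLemmas I

  pointOn : (B : Fin b) → ∃ λ q → I q B ≡ true
  pointOn B =
    countL-witness (allFin v) (λ q → I q B) (subst (0 <_) (sym (blockSize B)) (≤-trans (s≤s z≤n) 2≤k))

  0<r : 0 < r
  0<r with p , pB ← pointOn (fromℕ< r<b) = subst (0 <_) (replication p) (countL-pos (I p) (∈-allFin _) pB)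

  blockThrough : (q : Fin v) → ∃ λ B → I q B ≡ true
  blockThrough q = countL-witness (allFin b) (I q) (subst (0 <_) (sym (replication q)) 0<r)

  0<λ₁ : 0 < λ₁
  0<λ₁ with p , pB ← pointOn (fromℕ< r<b)
       with q , e ← countL-witness (allFin v) _ (subst (0 <_) (sym (flagCond p _ pB)) (m<n⇒0<n∸m 2≤k))
       with qB , rest ← ∧-true⁻ e with _ , lam≡λ₁ ← ∧-true⁻ rest
    = subst (0 <_) (≡ᵇ-true⇒≡ lam≡λ₁) (lam-pos _ pB qB)

  meets≡collinear : ∀ {p q} → p ≢ q → not (lam I p q ≡ᵇ 0) ≡ (lam I p q ≡ᵇ λ₁)
  meets≡collinear {p} {q} p≢q = nonzero≡equal 0<λ₁ (pairs p q p≢q)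
    where
    nonzero≡equal : ∀ {m n} → 0 < n → m ≡ n ⊎ m ≡ 0 → not (m ≡ᵇ 0) ≡ (m ≡ᵇ n)
    nonzero≡equal {n = suc n} _ (inj₁ refl) = sym (Equivalence.to T-≡ (≡⇒≡ᵇ n n refl))
    nonzero≡equal {n = suc n} _ (inj₂ refl) = refl

  module AroundPoint (p : Fin v) where

    isP : Fin v → Bool
    isP q = ⌊ p ≟ᶠ q ⌋

    collinear : Fin v → Bool
    collinear q = lam I p q ≡ᵇ λ₁

    near : Fin v → Bool
    near q = isP q ∨ collinear q

    near≡isP∨meets : ∀ q → near q ≡ isP q ∨ not (lam I q p ≡ᵇ 0)
    near≡isP∨meets q with p ≟ᶠ q
    ... | yes _   = refl
    ... | no p≢q = trans (sym (meets≡collinear p≢q)) (cong (λ n → not (n ≡ᵇ 0)) (lam-sym p q))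

    far-disjoint : ∀ {q} B → near q ≡ false → I q B ≡ true → I p B ≡ false
    far-disjoint {q} B nearq qB with p ≟ᶠ q | I p B in pB
    far-disjoint B () qB | yes _ | _
    ... | no _    | false = refl
    ... | no p≢q | true
      with () ← subst (0 <_) (≡ᵇ-true⇒≡ (not-injective (trans (meets≡collinear p≢q) nearq))) (lam-pos B pB qB)

    ball : ℕ → V → Bool
    ball 0 (inj₁ q) = isP q
    ball 0 (inj₂ B) = false
    ball 1 (inj₁ q) = isP q
    ball 1 (inj₂ B) = I p B
    ball 2 (inj₁ q) = near q
    ball 2 (inj₂ B) = I p B
    ball 3 (inj₁ q) = near q
    ball 3 (inj₂ B) = true
    ball (suc (suc (suc (suc _)))) _ = true

    ball-zero : ∀ w → within 0 (inj₁ p) w ≡ ball 0 w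
    ball-zero (inj₁ q) = trans (isYes≗does _) (sym (isYes≗does _))
    ball-zero (inj₂ B) = refl

    contains-p : ∀ B → not (countFin v (λ q → I q B ∧ isP q) ≡ᵇ 0) ≡ I p B
    contains-p B rewrite countFin-∧-≟ (λ q → I q B) p with I p B
    ... | true  = refl
    ... | false = refl

    ball-suc : ∀ n w → ball (suc n) w ≡ ball n w ∨ any (λ x → incAdj I x w ∧ ball n x) enum
    ball-suc 0 (inj₁ q) =
      sym (trans (cong (isP q ∨_) (trans (any-adj-point q (ball 0)) no-blocks)) (∨-identityʳ (isP q)))
      where
      no-blocks : not (countFin b (λ B → I q B ∧ false) ≡ᵇ 0) ≡ false
      no-blocks = cong (λ n → not (n ≡ᵇ 0)) (countL-none (allFin b) (λ B → ∧-zeroʳ (I q B)))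
    ball-suc 0 (inj₂ B) = sym (trans (any-adj-block B (ball 0)) (contains-p B))
    ball-suc 1 (inj₁ q) = trans (near≡isP∨meets q) (cong (isP q ∨_) (sym (any-adj-point q (ball 1))))
    ball-suc 1 (inj₂ B) =
      sym (trans (cong (I p B ∨_) (trans (any-adj-block B (ball 1)) (contains-p B))) (∨-idem (I p B)))
    ball-suc 2 (inj₁ q) = begin
      near q                 ≡⟨ near≡isP∨meets q ⟩
      isP q ∨ meets          ≡⟨ cong (isP q ∨_) (sym (∨-idem meets)) ⟩
      isP q ∨ (meets ∨ meets) ≡⟨ sym (∨-assoc (isP q) meets meets) ⟩
      (isP q ∨ meets) ∨ meets ≡⟨ cong₂ _∨_ (sym (near≡isP∨meets q)) (sym (any-adj-point q (ball 2))) ⟩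
      near q ∨ any (λ x → incAdj I x (inj₁ q) ∧ ball 2 x) enum ∎
      where
      open ≡-Reasoning
      meets : Bool
      meets = not (lam I q p ≡ᵇ 0)
    ball-suc 2 (inj₂ B) with I p B in pB
    ... | true  = refl
    -- t > 0: a block missing p contains a point collinear with p.
    ... | false
      with q , e ← countL-witness (allFin v) _ (subst (0 <_) (sym (nonFlagCond p B pB)) 0<t)
      with qB , col ← ∧-true⁻ e
      = sym (any-intro _ (enum-complete (inj₁ q)) (cong₂ _∧_ qB (trans (cong (isP q ∨_) col) (∨-zeroʳ (isP q)))))
    ball-suc 3 (inj₁ q) with B , qB ← blockThrough q
      = sym (trans (cong (near q ∨_) (any-intro _ (enum-complete (inj₂ B)) (cong (_∧ true) qB))) (∨-zeroʳ (near q)))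
    ball-suc 3 (inj₂ B) = refl
    ball-suc (suc (suc (suc (suc n)))) w = refl

    open Balls ball-zero ball-suc

    blocksIn : ℕ → Fin v → ℕ
    blocksIn i q = countFin b (λ B → I q B ∧ shell ball i (inj₂ B))

    pointsIn : ℕ → Fin b → ℕ
    pointsIn i B = countFin v (λ q → I q B ∧ shell ball i (inj₁ q))

    around-point : ∀ i q → count (λ x → incAdj I (inj₁ q) x ∧ atDist i (inj₁ p) x) ≡ blocksIn i q
    around-point i q = trans (count-atDist≡count-shell i (inj₁ q)) (count-around-point q (shell ball i))

    around-block : ∀ i B → count (λ x → incAdj I (inj₂ B) x ∧ atDist i (inj₁ p) x) ≡ pointsIn i B
    around-block i B = trans (count-atDist≡count-shell i (inj₂ B)) (count-around-block B (shell ball i))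

    IntersectionNumbers : ℕ → V → Set
    IntersectionNumbers i w = (cNum i (inj₁ p) w ≡ cSeq λ₁ t r i) × (aNum i (inj₁ p) w ≡ 0)
                            × (bNum i (inj₁ p) w ≡ bSeq r k λ₁ t i)

    intersectionNumbers-self : IntersectionNumbers 0 (inj₁ p)
    intersectionNumbers-self =
        refl
      , trans (around-point 0 p) (countL-none (allFin b) (λ B → ∧-zeroʳ (I p B)))
      , trans (around-point 1 p) (trans (countL-cong (allFin b) through-p) (replication p))
      where
      through-p : ∀ B → I p B ∧ (I p B ∧ true) ≡ I p B
      through-p B = trans (cong (I p B ∧_) (∧-identityʳ (I p B))) (∧-idem (I p B))

    intersectionNumbers-block∋p : ∀ {B} → I p B ≡ true → IntersectionNumbers 1 (inj₂ B)
    intersectionNumbers-block∋p {B} pB =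
        trans (around-block 0 B) (trans (countFin-∧-≟ (λ q → I q B) p) (cong (λ x → if x then 1 else 0) pB))
      , trans (around-block 1 B) (countL-none (allFin v) (λ q → ∧-contradiction (I q B) (isP q)))
      , trans (around-block 2 B)
              (trans (countL-cong (allFin v) (λ q → cong (I q B ∧_) (∨-∧-not (isP q) (collinear q)))) (flagCond p B pB))

    intersectionNumbers-collinear : ∀ {q} → collinear q ≡ true → IntersectionNumbers 2 (inj₁ q)
    intersectionNumbers-collinear {q} col =
        trans (around-point 1 q)
              (trans (countL-cong (allFin b) (λ B → cong (I q B ∧_) (∧-identityʳ (I p B)))) lam≡λ₁)
      , trans (around-point 2 q) (countL-none (allFin b) (λ B → ∧-contradiction (I q B) (I p B)))
      , trans (around-point 3 q) (countL-∧-not (allFin b) (I q) (I p) (replication q) lam≡λ₁)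
      where
      lam≡λ₁ : lam I q p ≡ λ₁
      lam≡λ₁ = trans (lam-sym q p) (≡ᵇ-true⇒≡ col)

    intersectionNumbers-block∌p : ∀ {B} → I p B ≡ false → IntersectionNumbers 3 (inj₂ B)
    intersectionNumbers-block∌p {B} pB =
        trans (around-block 2 B) (trans (countL-∧-cong (allFin v) near∧not-p) collinear-on-B)
      , trans (around-block 3 B) (countL-none (allFin v) (λ q → ∧-contradiction (I q B) (near q)))
      , trans (around-block 4 B) (trans (countL-∧-cong (allFin v) not-near)
                                        (countL-∧-not (allFin v) (λ q → I q B) collinear (blockSize B) collinear-on-B))
      where
      collinear-on-B : countFin v (λ q → I q B ∧ collinear q) ≡ t
      collinear-on-B = nonFlagCond p B pB
      not-p : ∀ q → I q B ≡ true → isP q ≡ false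
      not-p q qB with p ≟ᶠ q
      ... | yes refl with () ← trans (sym pB) qB
      ... | no _     = refl
      near∧not-p : ∀ q → I q B ≡ true → near q ∧ not (isP q) ≡ collinear q
      near∧not-p q qB rewrite not-p q qB = ∧-identityʳ (collinear q)
      not-near : ∀ q → I q B ≡ true → true ∧ not (near q) ≡ not (collinear q)
      not-near q qB rewrite not-p q qB = refl

    intersectionNumbers-far : ∀ {q} → near q ≡ false → IntersectionNumbers 4 (inj₁ q)
    intersectionNumbers-far {q} nearq =
        trans (around-point 3 q) (countL-∧-not (allFin b) (I q) (I p) (replication q) lam≡0)
      , trans (around-point 4 q) (countL-none (allFin b) (λ B → ∧-zeroʳ (I q B)))
      , trans (around-point 5 q) (countL-none (allFin b) (λ B → ∧-zeroʳ (I q B)))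
      where
      lam≡0 : lam I q p ≡ 0
      lam≡0 = countL-none (allFin b) disjoint
        where
        disjoint : ∀ B → I q B ∧ I p B ≡ false
        disjoint B with I q B in qB
        ... | true  = far-disjoint B nearq qB
        ... | false = refl

    intersectionNumbers-shell : ∀ i w → shell ball i w ≡ true → IntersectionNumbers i w
    intersectionNumbers-shell 0 (inj₁ q) e with refl ← isYes-sound _≟ᶠ_ e = intersectionNumbers-self
    intersectionNumbers-shell 1 (inj₁ q) e with () ← trans (sym (∧-inverseʳ (isP q))) e
    intersectionNumbers-shell 1 (inj₂ B) e = intersectionNumbers-block∋p (trans (sym (∧-identityʳ (I p B))) e)
    intersectionNumbers-shell 2 (inj₁ q) e with p ≟ᶠ q
    intersectionNumbers-shell 2 (inj₁ q) () | yes _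
    ... | no _ = intersectionNumbers-collinear (trans (sym (∧-identityʳ (collinear q))) e)
    intersectionNumbers-shell 2 (inj₂ B) e with () ← trans (sym (∧-inverseʳ (I p B))) e
    intersectionNumbers-shell 3 (inj₁ q) e with () ← trans (sym (∧-inverseʳ (near q))) e
    intersectionNumbers-shell 3 (inj₂ B) e = intersectionNumbers-block∌p (not-injective e)
    intersectionNumbers-shell 4 (inj₁ q) e = intersectionNumbers-far (not-injective e)

    intersectionNumbers : ∀ i w → atDist i (inj₁ p) w ≡ true → IntersectionNumbers i w
    intersectionNumbers i w e = intersectionNumbers-shell i w (trans (sym (atDist≡shell i w)) e)

    within-four : ∀ w → within 4 (inj₁ p) w ≡ true
    within-four w = within≡ball 4 w

  open AroundPoint using (intersectionNumbers; within-four)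

  distanceRegularized : ∀ p → DistanceRegularized (inj₁ p)
  distanceRegularized p i w w′ e e′
    with c , a , b ← intersectionNumbers p i w e | c′ , a′ , b′ ← intersectionNumbers p i w′ e′
    = trans c (sym c′) , trans a (sym a′) , trans b (sym b′)

  connected : Connected
  connected (inj₁ p) w = 4 , within-four p w
  connected (inj₂ B) w with q , qB ← pointOn B =
    5 , within-trans enum-complete 1 4 B→q (within-four q w)
    where
    B→q : within 1 (inj₂ B) (inj₁ q) ≡ true
    B→q = within-step enum-complete 0 {w = inj₁ q} (within-refl (inj₂ B)) qB

  pointIntersectionNumbers : ∀ u → isPoint u ≡ true → ∀ i w → atDist i u w ≡ true →
                             (bNum i u w ≡ bSeq r k λ₁ t i) × (cNum i u w ≡ cSeq λ₁ t r i)
  pointIntersectionNumbers (inj₁ p) _ i w e with c , _ , b ← intersectionNumbers p i w e = b , c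

lemma4p2 : (v b r k λ₁ t : ℕ) (I : Fin v → Fin b → Bool) →
    SPBIBD v b r k λ₁ 0 (k ∸ 1) t I → 0 < t → t < k →
    (∀ p → GraphNotions.DistanceRegularized (IncidenceGraph I) (inj₁ p)) ×
    GraphNotions.DistanceSemiregular (IncidenceGraph I) isPoint (bSeq r k λ₁ t) (cSeq λ₁ t r)
lemma4p2 v b r k λ₁ t I D 0<t _ =
  distanceRegularized , connected , incidence-bipartite , pointIntersectionNumbers
  where
  open IncidenceGraphLemmas I using (incidence-bipartite)
  open SPBIBDLemmas D 0<t
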